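{- Let $k\ge0$ be an integer and $j\ge1$. If $j\le2^{k-1}$ then $\Delta_{\mathbf d,2^k}(j)=\Delta_{\mathbf d}(j)$, and if $2^{k-1}<j\le2^k$ then $\Delta_{\mathbf d,2^k}(j)=0$.
   Context: The period-doubling sequence $\mathbf d=(d_n)_{n\ge 0}=1011101010111011\cdots$ is the fixed point starting with $1$ of the morphism $1\mapsto 10$, $0\mapsto 11$. For $q\ge0$ and $j\ge1$, the Hankel determinant of the shifted sequence is $\Delta_{\mathbf d,q}(j)=\det(d_{q+a+b})_{0\le a,b\le j-1}$, and $\Delta_{\mathbf d}(j)=\Delta_{\mathbf d,0}(j)$. -}

module Defs where

open import Data.Nat using (ℕ; zero; suc; _+_)
open import Data.Integer using (ℤ; -_; _*_) renaming (_+_ to _+ℤ_)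
import Data.Integer as ℤ
open import Data.Fin using (Fin; toℕ; punchIn) renaming (zero to fzero; suc to fsuc)
open import Data.List using (List; []; _∷_; concatMap; map; foldr; allFin)

μletter : ℕ → List ℕ
μletter 1 = 1 ∷ 0 ∷ []
μletter _ = 1 ∷ 1 ∷ []

μ : List ℕ → List ℕ
μ = concatMap μletter

iterμ : ℕ → List ℕ
iterμ zero    = 1 ∷ []
iterμ (suc m) = μ (iterμ m)

-- n-th letter of a word (0 outside its range; never used out of range below)
nth : List ℕ → ℕ → ℕ
nth []       _       = 0
nth (x ∷ _)  zero    = x
nth (_ ∷ xs) (suc n) = nth xs n

-- d_n : the fixed point of μ starting with 1; μ^(n+1)(1) is a prefix of it of
-- length 2^(n+1) > n, so its n-th letter is d_n.
d : ℕ → ℕ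
d n = nth (iterμ (suc n)) n

sign : ℕ → ℤ
sign zero    = ℤ.+ 1
sign (suc n) = - sign n

sumℤ : List ℤ → ℤ
sumℤ = foldr _+ℤ_ (ℤ.+ 0)

det : (n : ℕ) → (Fin n → Fin n → ℤ) → ℤ
det zero    M = ℤ.+ 1
det (suc n) M =
  sumℤ (map (λ i → sign (toℕ i) * M fzero i * det n (λ a b → M (fsuc a) (punchIn i b)))
            (allFin (suc n)))

Δq : ℕ → ℕ → ℤ
Δq q j = det j (λ a b → ℤ.+ d (q + toℕ a + toℕ b))

Δ : ℕ → ℤ
Δ j = Δq 0 j

-- The period-doubling sequence satisfies d(2n) = 1 and d(2n+1) = 1 - d(n).  Splitting
-- n by parity and inducting on k, this gives d(2^k + n) = d(n) for n ≤ 2^k - 2, so for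
-- 2j ≤ 2^k the shifted Hankel matrix of order j coincides with the unshifted one; and
-- d(2^k + r) = d(2^k + 2^(k-1) + r) for r < 2^k, so for 2^(k-1) < j ≤ 2^k columns 0 and
-- 2^(k-1) of the shifted Hankel matrix coincide and its determinant vanishes.  For the
-- latter the determinant is viewed as an alternating function of its list of columns.

module Submission where

open import Defs

module ColumnDeterminant where

  open import Data.Nat using (ℕ; zero; suc; _<_; z≤n; s≤s)
  open import Data.Integer using (ℤ; +_; -[1+_]; -_; _*_; _+_)
  import Data.Integer.Properties as ℤ
  open import Data.Integer.Tactic.RingSolver using (solve-∀)
  open import Data.Fin using (Fin; toℕ; punchIn) renaming (zero to fzero; suc to fsuc)
  open import Data.List using (List; []; _∷_; [_]; _++_; map; tabulate)
  open import Data.List.Properties using (++-assoc; map-tabulate; tabulate-cong)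
  open import Data.List.Relation.Binary.Pointwise as Pointwise using (Pointwise; []; _∷_; ++⁺)
  open import Data.List.Relation.Unary.Any using (Any; here; there)
  import Data.List.Relation.Unary.Any.Properties as Any
  open import Function using (id; _∘_)
  open import Relation.Binary.PropositionalEquality using (_≡_; refl; sym; trans; cong; cong₂; module ≡-Reasoning)

  Column : Set
  Column = ℕ → ℤ

  dropRow : Column → Column
  dropRow c r = c (suc r)

  -- The determinant of the n × n matrix whose columns (read from row 0 down) are
  -- listed, by Laplace expansion along row 0.  In expand n s xs cs the columns xs
  -- have already been expanded; each column c of cs contributes ± c 0 times the minor
  -- of all the other columns, with signs alternating from s.
  mutual
    detᶜ : ℕ → List Column → ℤ
    detᶜ zero    []      = + 1
    detᶜ zero    (_ ∷ _) = + 0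
    detᶜ (suc n) cs      = expand n (+ 1) [] cs

    expand : ℕ → ℤ → List Column → List Column → ℤ
    expand n s xs []       = + 0
    expand n s xs (c ∷ cs) = s * c 0 * detᶜ n (map dropRow (xs ++ cs)) + expand n (- s) (xs ++ [ c ]) cs

  private
    -s*t≡s*-t : ∀ s t → - s * t ≡ s * - t
    -s*t≡s*-t = solve-∀

  expand-tabulate : ∀ n {m} s xs (f : Fin (suc m) → Column) →
    expand n s xs (tabulate f) ≡
    sumℤ (tabulate λ i → s * sign (toℕ i) * f i 0 * detᶜ n (map dropRow (xs ++ tabulate (f ∘ punchIn i))))
  expand-tabulate n {zero}  s xs f =
    cong (λ t → t * f fzero 0 * detᶜ n (map dropRow (xs ++ [])) + + 0) (sym (ℤ.*-identityʳ s))
  expand-tabulate n {suc m} s xs f =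
    cong₂ _+_ (cong (λ t → t * f fzero 0 * detᶜ n (map dropRow (xs ++ tabulate (f ∘ fsuc))))
                    (sym (ℤ.*-identityʳ s)))
              (trans (expand-tabulate n (- s) (xs ++ [ f fzero ]) (f ∘ fsuc))
                     (cong sumℤ (tabulate-cong λ i →
                        cong₂ (λ t zs → t * f (fsuc i) 0 * detᶜ n (map dropRow zs))
                              (-s*t≡s*-t s (sign (toℕ i)))
                              (++-assoc xs [ f fzero ] (tabulate (f ∘ fsuc ∘ punchIn i))))))

  det≡detᶜ : ∀ n (g : ℕ → Fin n → ℤ) → det n (λ a b → g (toℕ a) b) ≡ detᶜ n (tabulate λ b r → g r b)
  det≡detᶜ zero    g = refl
  det≡detᶜ (suc n) g = begin
    det (suc n) (λ a b → g (toℕ a) b)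
      ≡⟨ cong sumℤ (map-tabulate id cofactor-term) ⟩
    sumℤ (tabulate cofactor-term)
      ≡⟨ cong sumℤ (tabulate-cong expansion-term) ⟩
    sumℤ (tabulate λ i → + 1 * sign (toℕ i) * g 0 i * detᶜ n (map dropRow ([] ++ tabulate λ b r → g r (punchIn i b))))
      ≡⟨ expand-tabulate n (+ 1) [] (λ b r → g r b) ⟨
    detᶜ (suc n) (tabulate λ b r → g r b) ∎
    where
    open ≡-Reasoning
    cofactor-term : Fin (suc n) → ℤ
    cofactor-term i = sign (toℕ i) * g 0 i * det n (λ a b → g (suc (toℕ a)) (punchIn i b))
    expansion-term : ∀ i → cofactor-term i ≡
                           + 1 * sign (toℕ i) * g 0 i * detᶜ n (map dropRow (tabulate λ b r → g r (punchIn i b)))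
    expansion-term i =
      cong₂ (λ t m → t * g 0 i * m) (sym (ℤ.*-identityˡ (sign (toℕ i))))
            (trans (det≡detᶜ n (λ r b → g (suc r) (punchIn i b)))
                   (cong (detᶜ n) (sym (map-tabulate _ dropRow))))

  data Swapped {A : Set} : List A → List A → Set where
    swap : ∀ a b cs → Swapped (a ∷ b ∷ cs) (b ∷ a ∷ cs)
    keep : ∀ c {cs cs'} → Swapped cs cs' → Swapped (c ∷ cs) (c ∷ cs')

  module _ {A : Set} where

    swapped-++ˡ : ∀ (xs : List A) {ys zs} → Swapped ys zs → Swapped (xs ++ ys) (xs ++ zs)
    swapped-++ˡ []       sw = sw
    swapped-++ˡ (x ∷ xs) sw = keep x (swapped-++ˡ xs sw)

    swapped-++ʳ : ∀ {xs ys : List A} zs → Swapped xs ys → Swapped (xs ++ zs) (ys ++ zs)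
    swapped-++ʳ zs (swap a b cs) = swap a b (cs ++ zs)
    swapped-++ʳ zs (keep c sw)   = keep c (swapped-++ʳ zs sw)

    swapped-snoc-snoc : ∀ (xs : List A) a b → Swapped ((xs ++ [ a ]) ++ [ b ]) ((xs ++ [ b ]) ++ [ a ])
    swapped-snoc-snoc []       a b = swap a b []
    swapped-snoc-snoc (x ∷ xs) a b = keep x (swapped-snoc-snoc xs a b)

    swapped-map : ∀ {B : Set} (f : A → B) {xs ys} → Swapped xs ys → Swapped (map f xs) (map f ys)
    swapped-map f (swap a b cs) = swap (f a) (f b) (map f cs)
    swapped-map f (keep c sw)   = keep (f c) (swapped-map f sw)

  private
    neg-*-+ : ∀ x y z → x * - y + - z ≡ - (x * y + z)
    neg-*-+ = solve-∀

    neg-swap : ∀ s a b p q e → s * a * p + (- s * b * q + - e) ≡ - (s * b * q + (- s * a * p + e))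
    neg-swap = solve-∀

  mutual
    detᶜ-swap : ∀ n {cs cs'} → Swapped cs cs' → detᶜ n cs ≡ - detᶜ n cs'
    detᶜ-swap zero    (swap _ _ _) = refl
    detᶜ-swap zero    (keep _ _)   = refl
    detᶜ-swap (suc n) sw           = expand-swapʳ n (+ 1) [] sw

    minor-swap : ∀ n {xs ys} → Swapped xs ys → detᶜ n (map dropRow xs) ≡ - detᶜ n (map dropRow ys)
    minor-swap n sw = detᶜ-swap n (swapped-map dropRow sw)

    expand-swapˡ : ∀ n s {xs xs'} cs → Swapped xs xs' → expand n s xs cs ≡ - expand n s xs' cs
    expand-swapˡ n s []       sw = refl
    expand-swapˡ n s (c ∷ cs) sw =
      trans (cong₂ (λ u v → s * c 0 * u + v)
                   (minor-swap n (swapped-++ʳ cs sw))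
                   (expand-swapˡ n (- s) cs (swapped-++ʳ [ c ] sw)))
            (neg-*-+ (s * c 0) _ _)

    expand-swapʳ : ∀ n s xs {cs cs'} → Swapped cs cs' → expand n s xs cs ≡ - expand n s xs cs'
    expand-swapʳ n s xs (swap a b cs)
      rewrite ++-assoc xs [ a ] cs | ++-assoc xs [ b ] cs
            | expand-swapˡ n (- - s) cs (swapped-snoc-snoc xs a b)
      = neg-swap s (a 0) (b 0) _ _ _
    expand-swapʳ n s xs (keep c sw) =
      trans (cong₂ (λ u v → s * c 0 * u + v)
                   (minor-swap n (swapped-++ˡ xs sw))
                   (expand-swapʳ n (- s) (xs ++ [ c ]) sw))
            (neg-*-+ (s * c 0) _ _)

  Agree : ℕ → Column → Column → Set
  Agree n c c' = ∀ r → r < n → c r ≡ c' r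

  agree-refl : ∀ {n c} → Agree n c c
  agree-refl _ _ = refl

  agree-dropRow : ∀ {n c c'} → Agree (suc n) c c' → Agree n (dropRow c) (dropRow c')
  agree-dropRow c≈c' r r<n = c≈c' (suc r) (s≤s r<n)

  mutual
    detᶜ-cong : ∀ n {cs cs'} → Pointwise (Agree n) cs cs' → detᶜ n cs ≡ detᶜ n cs'
    detᶜ-cong zero    []      = refl
    detᶜ-cong zero    (_ ∷ _) = refl
    detᶜ-cong (suc n) cs≈cs'  = expand-cong n (+ 1) [] cs≈cs'

    expand-cong : ∀ n s {xs xs' cs cs'} → Pointwise (Agree (suc n)) xs xs' →
                  Pointwise (Agree (suc n)) cs cs' → expand n s xs cs ≡ expand n s xs' cs'
    expand-cong n s xs≈xs' []               = refl
    expand-cong n s xs≈xs' (c≈c' ∷ cs≈cs') =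
      cong₂ _+_ (cong₂ (λ u v → s * u * v) (c≈c' 0 (s≤s z≤n))
                       (detᶜ-cong n (Pointwise.map⁺ dropRow dropRow
                                      (Pointwise.map agree-dropRow (++⁺ xs≈xs' cs≈cs')))))
                (expand-cong n (- s) (++⁺ xs≈xs' (c≈c' ∷ [])) cs≈cs')

  private
    i≡-i⇒i≡0 : ∀ i → i ≡ - i → i ≡ + 0
    i≡-i⇒i≡0 (+ zero)      _  = refl
    i≡-i⇒i≡0 (+ suc _)     ()
    i≡-i⇒i≡0 -[1+ _ ]     ()

  -- Move the first of the two agreeing columns rightwards until they are adjacent; there
  -- swapping them both negates the determinant and leaves it unchanged.
  detᶜ-agreeing-columns : ∀ n xs {a cs} → Any (Agree n a) cs → detᶜ n (xs ++ a ∷ cs) ≡ + 0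
  detᶜ-agreeing-columns n xs {a} (here {b} {ys} a≈b) =
    i≡-i⇒i≡0 _ (trans (detᶜ-swap n (swapped-++ˡ xs (swap a b ys)))
                      (cong -_ (detᶜ-cong n (++⁺ (Pointwise.refl agree-refl)
                                                 (b≈a ∷ a≈b ∷ Pointwise.refl agree-refl)))))
    where
    b≈a : Agree n b a
    b≈a r r<n = sym (a≈b r r<n)
  detᶜ-agreeing-columns n xs {a} (there {m} {ys} a∈ys) = begin
    detᶜ n (xs ++ a ∷ m ∷ ys)          ≡⟨ detᶜ-swap n (swapped-++ˡ xs (swap a m ys)) ⟩
    - detᶜ n (xs ++ m ∷ a ∷ ys)        ≡⟨ cong (λ zs → - detᶜ n zs) (++-assoc xs [ m ] (a ∷ ys)) ⟨
    - detᶜ n ((xs ++ [ m ]) ++ a ∷ ys) ≡⟨ cong -_ (detᶜ-agreeing-columns n (xs ++ [ m ]) a∈ys) ⟩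
    + 0                                ∎
    where open ≡-Reasoning

  detᶜ-tabulate-agreeing : ∀ n {m} xs (f : Fin m → Column) {i k} →
    toℕ i < toℕ k → Agree n (f i) (f k) → detᶜ n (xs ++ tabulate f) ≡ + 0
  detᶜ-tabulate-agreeing n xs f {fzero}  {fsuc k} _ fi≈fk =
    detᶜ-agreeing-columns n xs (Any.tabulate⁺ k fi≈fk)
  detᶜ-tabulate-agreeing n xs f {fsuc i} {fsuc k} (s≤s i<k) fi≈fk =
    trans (cong (detᶜ n) (sym (++-assoc xs [ f fzero ] (tabulate (f ∘ fsuc)))))
          (detᶜ-tabulate-agreeing n (xs ++ [ f fzero ]) (f ∘ fsuc) i<k fi≈fk)

module PeriodDoubling where

  open import Data.Nat using (ℕ; zero; suc; _+_; _*_; _^_; _≤_; _<_; z≤n; s≤s)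
  open import Data.Nat.Properties
    using (*-suc; *-distribˡ-+; +-suc; +-comm; +-identityʳ; +-mono-≤; +-monoʳ-<; *-cancelˡ-<; m^n>0;
           ^-monoʳ-≤; ≤-trans; ≤-reflexive; <-trans; <-≤-trans; ≤-<-trans; <⇒≤; m≤m+n; m≤n+m; n≤1+n; n<1+n)
  open import Data.List using (List; []; _∷_; length)
  open import Function using (_∘_)
  open import Relation.Binary.PropositionalEquality using (_≡_; refl; sym; trans; cong; subst; module ≡-Reasoning)

  complement : ℕ → ℕ
  complement 1 = 0
  complement _ = 1

  μletter≡ : ∀ x → μletter x ≡ 1 ∷ complement x ∷ []
  μletter≡ 0             = refl
  μletter≡ 1             = refl
  μletter≡ (suc (suc _)) = refl

  length-μ : ∀ w → length (μ w) ≡ 2 * length w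
  length-μ []      = refl
  length-μ (x ∷ w) rewrite μletter≡ x = trans (cong (2 +_) (length-μ w)) (sym (*-suc 2 (length w)))

  length-iterμ : ∀ m → length (iterμ m) ≡ 2 ^ m
  length-iterμ zero    = refl
  length-iterμ (suc m) = trans (length-μ (iterμ m)) (cong (2 *_) (length-iterμ m))

  nth-μ-∷ : ∀ x w k → nth (μ (x ∷ w)) (2 + k) ≡ nth (μ w) k
  nth-μ-∷ x w k rewrite μletter≡ x = refl

  nth-μ-even : ∀ w n → n < length w → nth (μ w) (2 * n) ≡ 1
  nth-μ-even (x ∷ w) zero    _         rewrite μletter≡ x = refl
  nth-μ-even (x ∷ w) (suc n) (s≤s n<w) =
    trans (cong (nth (μ (x ∷ w))) (*-suc 2 n)) (trans (nth-μ-∷ x w (2 * n)) (nth-μ-even w n n<w))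

  nth-μ-odd : ∀ w n → n < length w → nth (μ w) (suc (2 * n)) ≡ complement (nth w n)
  nth-μ-odd (x ∷ w) zero    _         rewrite μletter≡ x = refl
  nth-μ-odd (x ∷ w) (suc n) (s≤s n<w) =
    trans (cong (nth (μ (x ∷ w)) ∘ suc) (*-suc 2 n)) (trans (nth-μ-∷ x w (suc (2 * n))) (nth-μ-odd w n n<w))

  data Parity : ℕ → Set where
    even : ∀ s → Parity (2 * s)
    odd  : ∀ s → Parity (suc (2 * s))

  parity : ∀ n → Parity n
  parity zero = even 0
  parity (suc n) with parity n
  ... | even s = odd s
  ... | odd s  = subst Parity (*-suc 2 s) (even (suc s))

  n<2^n : ∀ n → n < 2 ^ n
  n<2^n zero    = s≤s z≤n
  n<2^n (suc n) = ≤-trans (+-mono-≤ (m^n>0 2 n) (n<2^n n))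
                          (≤-reflexive (cong (2 ^ n +_) (sym (+-identityʳ (2 ^ n)))))

  nth-iterμ-even : ∀ m s → s < 2 ^ m → nth (iterμ (suc m)) (2 * s) ≡ 1
  nth-iterμ-even m s s<2^m = nth-μ-even (iterμ m) s (subst (s <_) (sym (length-iterμ m)) s<2^m)

  nth-iterμ-odd : ∀ m s → s < 2 ^ m → nth (iterμ (suc m)) (suc (2 * s)) ≡ complement (nth (iterμ m) s)
  nth-iterμ-odd m s s<2^m = nth-μ-odd (iterμ m) s (subst (s <_) (sym (length-iterμ m)) s<2^m)

  nth-iterμ-suc : ∀ m n → n < 2 ^ m → nth (iterμ m) n ≡ nth (iterμ (suc m)) n
  nth-iterμ-suc zero    zero    _         = refl
  nth-iterμ-suc zero    (suc n) (s≤s ())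
  nth-iterμ-suc (suc m) n n<2^[1+m] with parity n
  ... | even s = trans (nth-iterμ-even m s s<2^m)
                       (sym (nth-iterμ-even (suc m) s (<-≤-trans s<2^m (^-monoʳ-≤ 2 (n≤1+n m)))))
    where
    s<2^m = *-cancelˡ-< 2 s (2 ^ m) n<2^[1+m]
  ... | odd s  = trans (nth-iterμ-odd m s s<2^m)
                       (trans (cong complement (nth-iterμ-suc m s s<2^m))
                              (sym (nth-iterμ-odd (suc m) s (<-≤-trans s<2^m (^-monoʳ-≤ 2 (n≤1+n m))))))
    where
    s<2^m = *-cancelˡ-< 2 s (2 ^ m) (<⇒≤ n<2^[1+m])

  nth-iterμ-+ : ∀ k m n → n < 2 ^ m → nth (iterμ m) n ≡ nth (iterμ (k + m)) n
  nth-iterμ-+ zero    m n n<2^m = refl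
  nth-iterμ-+ (suc k) m n n<2^m =
    trans (nth-iterμ-+ k m n n<2^m)
          (nth-iterμ-suc (k + m) n (<-≤-trans n<2^m (^-monoʳ-≤ 2 (m≤n+m m k))))

  nth-iterμ≡d : ∀ m n → n < 2 ^ m → nth (iterμ m) n ≡ d n
  nth-iterμ≡d m n n<2^m = begin
    nth (iterμ m) n                ≡⟨ nth-iterμ-+ (suc n) m n n<2^m ⟩
    nth (iterμ (suc n + m)) n      ≡⟨ cong (λ l → nth (iterμ l) n) (+-comm (suc n) m) ⟩
    nth (iterμ (m + suc n)) n      ≡⟨ nth-iterμ-+ m (suc n) n (<-≤-trans (n<2^n n) (m≤m+n (2 ^ n) _)) ⟨
    d n                            ∎
    where open ≡-Reasoning

  d-even : ∀ n → d (2 * n) ≡ 1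
  d-even n = nth-iterμ-even (2 * n) n (≤-<-trans (m≤m+n n _) (n<2^n (2 * n)))

  d-odd : ∀ n → d (suc (2 * n)) ≡ complement (d n)
  d-odd n = trans (nth-iterμ-odd (suc (2 * n)) n n<2^[1+2n])
                  (cong complement (nth-iterμ≡d (suc (2 * n)) n n<2^[1+2n]))
    where
    n<2^[1+2n] : n < 2 ^ suc (2 * n)
    n<2^[1+2n] = ≤-<-trans (≤-trans (m≤m+n n _) (n≤1+n _)) (n<2^n (suc (2 * n)))

  d[2a+r]≡d[2b+r] : ∀ a b r → (∀ s → 2 * s < r → d (a + s) ≡ d (b + s)) → d (2 * a + r) ≡ d (2 * b + r)
  d[2a+r]≡d[2b+r] a b r agree with parity r
  ... | even s = trans (even-at a) (sym (even-at b))
    where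
    even-at : ∀ c → d (2 * c + 2 * s) ≡ 1
    even-at c = trans (cong d (sym (*-distribˡ-+ 2 c s))) (d-even (c + s))
  ... | odd s = trans (odd-at a) (trans (cong complement (agree s (n<1+n _))) (sym (odd-at b)))
    where
    odd-at : ∀ c → d (2 * c + suc (2 * s)) ≡ complement (d (c + s))
    odd-at c = trans (cong d (trans (+-suc (2 * c) (2 * s)) (cong suc (sym (*-distribˡ-+ 2 c s)))))
                     (d-odd (c + s))

  d[2^k+n]≡d[n] : ∀ k n → 2 + n ≤ 2 ^ k → d (2 ^ k + n) ≡ d n
  d[2^k+n]≡d[n] zero    n (s≤s ())
  d[2^k+n]≡d[n] (suc k) n 2+n≤2^[1+k] = d[2a+r]≡d[2b+r] (2 ^ k) 0 n λ s 2s<n →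
    d[2^k+n]≡d[n] k s (*-cancelˡ-< 2 (suc s) (2 ^ k)
      (subst (_< 2 * 2 ^ k) (sym (*-suc 2 s)) (<-≤-trans (+-monoʳ-< 2 2s<n) 2+n≤2^[1+k])))

  d[2·2^m+r]≡d[3·2^m+r] : ∀ m r → r < 2 ^ suc m → d (2 ^ suc m + r) ≡ d (2 ^ suc m + 2 ^ m + r)
  d[2·2^m+r]≡d[3·2^m+r] zero    0             _ = refl
  d[2·2^m+r]≡d[3·2^m+r] zero    1             _ = refl
  d[2·2^m+r]≡d[3·2^m+r] zero    (suc (suc _)) (s≤s (s≤s ()))
  d[2·2^m+r]≡d[3·2^m+r] (suc m) r r<2^[2+m] =
    trans (d[2a+r]≡d[2b+r] (2 ^ suc m) (2 ^ suc m + 2 ^ m) r λ s 2s<r →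
             d[2·2^m+r]≡d[3·2^m+r] m s (*-cancelˡ-< 2 s (2 ^ suc m) (<-trans 2s<r r<2^[2+m])))
          (cong (λ x → d (x + r)) (*-distribˡ-+ 2 (2 ^ suc m) (2 ^ m)))

open import Data.Nat using (ℕ; zero; suc; _+_; _*_; _^_; _≤_; _<_; s≤s)
open import Data.Nat.Properties using (+-assoc; +-comm; +-suc; +-identityʳ; +-mono-≤; ≤-trans; <-≤-trans; m^n>0; *-cancelˡ-<)
open import Data.Fin using (Fin; toℕ; fromℕ<) renaming (zero to fzero)
open import Data.Fin.Properties using (toℕ<n; toℕ-fromℕ<)
open import Data.List using ([]; tabulate)
open import Data.List.Relation.Binary.Pointwise using (tabulate⁺)
open import Data.Product using (_×_; _,_)
open import Relation.Binary.PropositionalEquality using (_≡_; refl; sym; trans; cong; subst; subst₂; module ≡-Reasoning)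
import Data.Integer as ℤ

open ColumnDeterminant
open PeriodDoubling

hankel : ℕ → (j : ℕ) → Fin j → Column
hankel q j b r = ℤ.+ d (q + r + toℕ b)

Δq≡detᶜ : ∀ q j → Δq q j ≡ detᶜ j (tabulate (hankel q j))
Δq≡detᶜ q j = det≡detᶜ j (λ r b → hankel q j b r)

Δq[2^k]≡Δ : ∀ k j → 2 * j ≤ 2 ^ k → Δq (2 ^ k) j ≡ Δ j
Δq[2^k]≡Δ k j 2j≤2^k =
  trans (Δq≡detᶜ (2 ^ k) j) (trans (detᶜ-cong j (tabulate⁺ agree)) (sym (Δq≡detᶜ 0 j)))
  where
  2+[r+b]≤2j : ∀ {r b} → r < j → b < j → 2 + (r + b) ≤ 2 * j
  2+[r+b]≤2j {r} {b} r<j b<j =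
    subst₂ _≤_ (cong suc (+-suc r b)) (cong (j +_) (sym (+-identityʳ j))) (+-mono-≤ r<j b<j)
  agree : ∀ b → Agree j (hankel (2 ^ k) j b) (hankel 0 j b)
  agree b r r<j = cong ℤ.+_ (trans (cong d (+-assoc (2 ^ k) r (toℕ b)))
                                   (d[2^k+n]≡d[n] k (r + toℕ b) (≤-trans (2+[r+b]≤2j r<j (toℕ<n b)) 2j≤2^k)))

Δq[2·2^m]≡0 : ∀ m j → 2 ^ m < j → j ≤ 2 ^ suc m → Δq (2 ^ suc m) j ≡ ℤ.+ 0
Δq[2·2^m]≡0 m zero    ()
Δq[2·2^m]≡0 m (suc j) 2^m<j j≤2^[1+m] =
  trans (Δq≡detᶜ K (suc j))
        (detᶜ-tabulate-agreeing (suc j) [] (hankel K (suc j)) {fzero} {k} 0<k agree)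
  where
  open ≡-Reasoning
  K = 2 ^ suc m
  k : Fin (suc j)
  k = fromℕ< 2^m<j
  0<k : 0 < toℕ k
  0<k = subst (0 <_) (sym (toℕ-fromℕ< 2^m<j)) (m^n>0 2 m)
  agree : Agree (suc j) (hankel K (suc j) fzero) (hankel K (suc j) k)
  agree r r<j = cong ℤ.+_ (begin
    d (K + r + 0)      ≡⟨ cong d (+-identityʳ (K + r)) ⟩
    d (K + r)          ≡⟨ d[2·2^m+r]≡d[3·2^m+r] m r (<-≤-trans r<j j≤2^[1+m]) ⟩
    d (K + 2 ^ m + r)  ≡⟨ cong d (trans (+-assoc K (2 ^ m) r)
                                  (trans (cong (K +_) (+-comm (2 ^ m) r)) (sym (+-assoc K r (2 ^ m))))) ⟩
    d (K + r + 2 ^ m)  ≡⟨ cong (λ x → d (K + r + x)) (toℕ-fromℕ< 2^m<j) ⟨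
    d (K + r + toℕ k)  ∎)

Δq[2^k]≡0 : ∀ k j → 2 ^ k < 2 * j → j ≤ 2 ^ k → Δq (2 ^ k) j ≡ ℤ.+ 0
Δq[2^k]≡0 zero    1             _       _     = refl
Δq[2^k]≡0 zero    (suc (suc _)) _       (s≤s ())
Δq[2^k]≡0 (suc m) j             2^k<2j j≤2^k = Δq[2·2^m]≡0 m j (*-cancelˡ-< 2 (2 ^ m) j 2^k<2j) j≤2^k

proposition12 : (k j : ℕ) → 1 ≤ j →
    (2 * j ≤ 2 ^ k → Δq (2 ^ k) j ≡ Δ j) ×
    (2 ^ k < 2 * j → j ≤ 2 ^ k → Δq (2 ^ k) j ≡ ℤ.+ 0)
proposition12 k j _ = Δq[2^k]≡Δ k j , Δq[2^k]≡0 k j
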